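{- Let $Z$ be the semigroup on $\{0,a,b,b^2,c\}$ with $a\cdot a=a\cdot b=b\cdot a=c$, $b\cdot b=b^2$, and all other products equal to $0$. Then for every natural number $n$ there exist a finite semigroup $X$ with $|X|\ge n$ and a surjective homomorphism $f\colon X\to Z$ such that $X$ is an $f$-core.
   Context: A retraction $r\colon X\to X$ is a homomorphism with $r\circ r=r$; it respects $f\colon X\to Z$ if $f\circ r=f$. Given $f\colon X\to Z$, an algebra $A$ is an $f$-core of $X$ if $A$ is minimal with respect to the existence of a retraction $r\colon X\to X$ onto $A$ respecting $f$; $X$ is an \emph{$f$-core} if it is its own $f$-core. -}

module Defs where

open import Data.Nat using (ℕ)
open import Data.Fin using (Fin)
open import Data.Product using (∃; _×_)
open import Relation.Binary.PropositionalEquality using (_≡_)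

data Z : Set where
  z0 a b b² c : Z

_·_ : Z → Z → Z
a · a = c
a · b = c
b · a = c
b · b = b²
_ · _ = z0

-- A finite semigroup: carrier Fin m (any finite semigroup is isomorphic to one
-- of this form) with an associative binary operation.
record FinSemigroup : Set where
  field
    size  : ℕ
    _∙_   : Fin size → Fin size → Fin size
    assoc : ∀ x y w → ((x ∙ y) ∙ w) ≡ (x ∙ (y ∙ w))

open FinSemigroup public

IsHomToZ : (X : FinSemigroup) → (Fin (size X) → Z) → Set
IsHomToZ X f = ∀ x y → f (_∙_ X x y) ≡ (f x · f y)

IsEndo : (X : FinSemigroup) → (Fin (size X) → Fin (size X)) → Set
IsEndo X r = ∀ x y → r (_∙_ X x y) ≡ _∙_ X (r x) (r y)

IsRetraction : (X : FinSemigroup) → (Fin (size X) → Fin (size X)) → Set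
IsRetraction X r = IsEndo X r × (∀ x → r (r x) ≡ r x)

Respects : (X : FinSemigroup) → (Fin (size X) → Fin (size X)) → (Fin (size X) → Z) → Set
Respects X r f = ∀ x → f (r x) ≡ f x

Surjective : {A B : Set} → (A → B) → Set
Surjective {A} {B} g = ∀ y → ∃ λ x → g x ≡ y

-- X is an f-core: X is minimal among subalgebras A ⊆ X admitting a retraction
-- X → X onto A respecting f; i.e. the image of every such retraction is all of X.
IsFCore : (X : FinSemigroup) → (Fin (size X) → Z) → Set
IsFCore X f = ∀ r → IsRetraction X r → Respects X r f → Surjective r

-- For N ≥ 1 we build a 3-nilpotent semigroup X_N with generators β, α₀, …, α_{N-1}
-- and null elements 𝟘, β², γ, ε₀, …, ε_{N-1}; the only nonzero products are
--   β·β = β²,  α_i·β = β·α_i = γ,  α_i·α_i = ε_i,  α_i·α_j = γ (i ≠ j),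
-- and f : X_N → Z sends α_i ↦ a, β ↦ b, β² ↦ b², γ, ε_i ↦ c, 𝟘 ↦ 0.
-- Since every product of three elements is 𝟘, X_N is a semigroup, and f is a
-- surjective homomorphism.  X_N is an f-core because every idempotent
-- endomorphism R with f ∘ R = f is the identity: R fixes β (the only preimage
-- of b) and sends α_i to some α_k; if k ≠ i then R α_k = α_k and
--   γ = R γ = R (α_i α_k) = α_k α_k = ε_k,
-- a contradiction, so R fixes every generator and hence every product.
module Submission where

open import Defs
open import Data.Nat using (ℕ; _+_; _≥_; suc)
open import Data.Nat.Properties using (≤-trans; m≤m+n; m≤n+m)
open import Data.Fin using (Fin; zero; suc; _≟_)
open import Data.Fin.Properties using (+↔⊎)
open import Data.Sum using (_⊎_; inj₁; inj₂)
open import Data.Sum.Function.Propositional using (_⊎-↔_)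
open import Data.Product using (Σ; ∃; _×_; _,_)
open import Data.Empty using (⊥-elim)
open import Function using (_∘_; Inverse; _↔_; mk↔ₛ′)
open import Function.Properties.Inverse using (↔-trans)
open import Relation.Nullary using (yes; no)
open import Relation.Binary.PropositionalEquality
  using (_≡_; _≢_; refl; sym; trans; cong; cong₂; module ≡-Reasoning)

IsRigid : {E : Set} → (E → E → E) → (E → Z) → Set
IsRigid {E} _*_ g =
  (R : E → E) → (∀ x y → R (x * y) ≡ R x * R y) → (∀ x → R (R x) ≡ R x) →
  (∀ x → g (R x) ≡ g x) → ∀ x → R x ≡ x

module Transport {E : Set} {m : ℕ} (code : Fin m ↔ E)
                 (_*_ : E → E → E)
                 (*-assoc : ∀ x y w → (x * y) * w ≡ x * (y * w)) where

  open Inverse code using ()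
    renaming (to to decode; from to encode;
              strictlyInverseˡ to decode-encode; strictlyInverseʳ to encode-decode)

  _⋆_ : Fin m → Fin m → Fin m
  x ⋆ y = encode (decode x * decode y)

  decode-⋆ : ∀ x y → decode (x ⋆ y) ≡ decode x * decode y
  decode-⋆ x y = decode-encode (decode x * decode y)

  encode-* : ∀ x y → encode (x * y) ≡ encode x ⋆ encode y
  encode-* x y = sym (cong encode (cong₂ _*_ (decode-encode x) (decode-encode y)))

  ⋆-assoc : ∀ x y w → (x ⋆ y) ⋆ w ≡ x ⋆ (y ⋆ w)
  ⋆-assoc x y w = cong encode (begin
    decode (x ⋆ y) * decode w        ≡⟨ cong (_* decode w) (decode-⋆ x y) ⟩
    (decode x * decode y) * decode w ≡⟨ *-assoc (decode x) (decode y) (decode w) ⟩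
    decode x * (decode y * decode w) ≡⟨ cong (decode x *_) (decode-⋆ y w) ⟨
    decode x * decode (y ⋆ w)        ∎)
    where open ≡-Reasoning

  semigroup : FinSemigroup
  semigroup = record { size = m ; _∙_ = _⋆_ ; assoc = ⋆-assoc }

  hom-transport : (g : E → Z) → (∀ x y → g (x * y) ≡ (g x · g y)) →
                  IsHomToZ semigroup (g ∘ decode)
  hom-transport g g-hom x y = trans (cong g (decode-⋆ x y)) (g-hom (decode x) (decode y))

  surjective-transport : (g : E → Z) → Surjective g → Surjective (g ∘ decode)
  surjective-transport g g-surj z with g-surj z
  ... | e , ge≡z = encode e , trans (cong g (decode-encode e)) ge≡z

  -- A retraction r of the transported semigroup respecting g ∘ decode is
  -- conjugate to a retraction of E respecting g, which rigidity makes trivial.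
  core-transport : (g : E → Z) → IsRigid _*_ g → IsFCore semigroup (g ∘ decode)
  core-transport g rigid r (r-endo , r-idem) r-resp y = y , r-fixes-y
    where
    R : E → E
    R = decode ∘ r ∘ encode

    R-hom : ∀ x y → R (x * y) ≡ R x * R y
    R-hom x y = begin
      decode (r (encode (x * y)))         ≡⟨ cong (decode ∘ r) (encode-* x y) ⟩
      decode (r (encode x ⋆ encode y))    ≡⟨ cong decode (r-endo (encode x) (encode y)) ⟩
      decode (r (encode x) ⋆ r (encode y)) ≡⟨ decode-⋆ (r (encode x)) (r (encode y)) ⟩
      R x * R y                           ∎
      where open ≡-Reasoning

    R-idem : ∀ x → R (R x) ≡ R x
    R-idem x = trans (cong (decode ∘ r) (encode-decode (r (encode x))))
                     (cong decode (r-idem (encode x)))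

    R-resp : ∀ x → g (R x) ≡ g x
    R-resp x = trans (r-resp (encode x)) (cong g (decode-encode x))

    r-fixes-y : r y ≡ y
    r-fixes-y = begin
      r y                   ≡⟨ encode-decode (r y) ⟨
      encode (decode (r y)) ≡⟨ cong (encode ∘ decode ∘ r) (encode-decode y) ⟨
      encode (R (decode y)) ≡⟨ cong encode (rigid R R-hom R-idem R-resp (decode y)) ⟩
      encode (decode y)     ≡⟨ encode-decode y ⟩
      y                     ∎
      where open ≡-Reasoning

data Gen (N : ℕ) : Set where
  β : Gen N
  α : Fin N → Gen N

data Null (N : ℕ) : Set where
  𝟘 β² γ : Null N
  ε : Fin N → Null N

data Elt (N : ℕ) : Set where
  gen : Gen N → Elt N
  nul : Null N → Elt N

module _ {N : ℕ} where

  _⊗_ : Gen N → Gen N → Null N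
  β ⊗ β = β²
  β ⊗ α _ = γ
  α _ ⊗ β = γ
  α i ⊗ α j with i ≟ j
  ... | yes _ = ε i
  ... | no _ = γ

  _⊙_ : Elt N → Elt N → Null N
  gen g ⊙ gen h = g ⊗ h
  _ ⊙ _ = 𝟘

  _*_ : Elt N → Elt N → Elt N
  x * y = nul (x ⊙ y)

  -- Every product is null and null elements annihilate, so both bracketings
  -- of a triple product are 𝟘.
  *-assoc : ∀ x y w → (x * y) * w ≡ x * (y * w)
  *-assoc (gen _) _ _ = refl
  *-assoc (nul _) _ _ = refl

  α-square : ∀ k → α k ⊗ α k ≡ ε k
  α-square k with k ≟ k
  ... | yes _ = refl
  ... | no k≢k = ⊥-elim (k≢k refl)

  α-distinct : ∀ {i k} → i ≢ k → α i ⊗ α k ≡ γ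
  α-distinct {i} {k} i≢k with i ≟ k
  ... | yes i≡k = ⊥-elim (i≢k i≡k)
  ... | no _ = refl

  f : Elt N → Z
  f (gen β) = b
  f (gen (α _)) = a
  f (nul 𝟘) = z0
  f (nul β²) = b²
  f (nul γ) = c
  f (nul (ε _)) = c

  f-hom-gen : ∀ g h → f (nul (g ⊗ h)) ≡ (f (gen g) · f (gen h))
  f-hom-gen β β = refl
  f-hom-gen β (α _) = refl
  f-hom-gen (α _) β = refl
  f-hom-gen (α i) (α j) with i ≟ j
  ... | yes _ = refl
  ... | no _ = refl

  f-null-annihilates : ∀ x z → (x · f (nul z)) ≡ z0
  f-null-annihilates a 𝟘 = refl
  f-null-annihilates a β² = refl
  f-null-annihilates a γ = refl
  f-null-annihilates a (ε _) = refl
  f-null-annihilates b 𝟘 = refl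
  f-null-annihilates b β² = refl
  f-null-annihilates b γ = refl
  f-null-annihilates b (ε _) = refl
  f-null-annihilates z0 _ = refl
  f-null-annihilates b² _ = refl
  f-null-annihilates c _ = refl

  f-hom : ∀ x y → f (x * y) ≡ (f x · f y)
  f-hom (gen g) (gen h) = f-hom-gen g h
  f-hom (gen g) (nul z) = sym (f-null-annihilates (f (gen g)) z)
  f-hom (nul 𝟘) _ = refl
  f-hom (nul β²) _ = refl
  f-hom (nul γ) _ = refl
  f-hom (nul (ε _)) _ = refl

  f-surjective : Fin N → Surjective f
  f-surjective i z0 = nul 𝟘 , refl
  f-surjective i a = gen (α i) , refl
  f-surjective i b = gen β , refl
  f-surjective i b² = nul β² , refl
  f-surjective i c = nul γ , refl

  fibre-b : ∀ x → f x ≡ b → x ≡ gen β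
  fibre-b (gen β) _ = refl
  fibre-b (nul 𝟘) ()
  fibre-b (nul β²) ()
  fibre-b (nul γ) ()
  fibre-b (nul (ε _)) ()

  fibre-a : ∀ x → f x ≡ a → ∃ λ k → x ≡ gen (α k)
  fibre-a (gen (α k)) _ = k , refl
  fibre-a (nul 𝟘) ()
  fibre-a (nul β²) ()
  fibre-a (nul γ) ()
  fibre-a (nul (ε _)) ()

  module Rigidity (R : Elt N → Elt N)
                  (R-hom : ∀ x y → R (x * y) ≡ R x * R y)
                  (R-idem : ∀ x → R (R x) ≡ R x)
                  (R-resp : ∀ x → f (R x) ≡ f x) where

    fixes-product : ∀ {x y} → R x ≡ x → R y ≡ y → R (x * y) ≡ x * y
    fixes-product Rx≡x Ry≡y = trans (R-hom _ _) (cong₂ _*_ Rx≡x Ry≡y)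

    R-β : R (gen β) ≡ gen β
    R-β = fibre-b (R (gen β)) (R-resp (gen β))

    R-α-generator : ∀ i → ∃ λ k → R (gen (α i)) ≡ gen (α k)
    R-α-generator i = fibre-a (R (gen (α i))) (R-resp (gen (α i)))

    -- γ = α_i β is fixed, since R α_i is again some α_k.
    R-γ : Fin N → R (nul γ) ≡ nul γ
    R-γ i with R-α-generator i
    ... | k , Rαi≡αk = trans (R-hom (gen (α i)) (gen β)) (cong₂ _*_ Rαi≡αk R-β)

    -- If R α_i = α_k with k ≠ i, then R α_k = α_k by idempotence and
    -- γ = R γ = R (α_i α_k) = α_k α_k = ε_k.
    R-α : ∀ i → R (gen (α i)) ≡ gen (α i)
    R-α i with R-α-generator i
    ... | k , Rαi≡αk with i ≟ k
    ...   | yes refl = Rαi≡αk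
    ...   | no i≢k = ⊥-elim (γ≢ε γ≡εk)
      where
      γ≢ε : nul γ ≢ nul (ε k)
      γ≢ε ()

      Rαk≡αk : R (gen (α k)) ≡ gen (α k)
      Rαk≡αk = trans (cong R (sym Rαi≡αk)) (trans (R-idem (gen (α i))) Rαi≡αk)

      γ≡εk : nul γ ≡ nul (ε k)
      γ≡εk = begin
        nul γ                        ≡⟨ R-γ i ⟨
        R (nul γ)                    ≡⟨ cong (R ∘ nul) (α-distinct i≢k) ⟨
        R (gen (α i) * gen (α k))    ≡⟨ R-hom (gen (α i)) (gen (α k)) ⟩
        R (gen (α i)) * R (gen (α k)) ≡⟨ cong₂ _*_ Rαi≡αk Rαk≡αk ⟩
        nul (α k ⊗ α k)              ≡⟨ cong nul (α-square k) ⟩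
        nul (ε k)                    ∎
        where open ≡-Reasoning

    R-β² : R (nul β²) ≡ nul β²
    R-β² = fixes-product R-β R-β

    -- Every element is a generator or a product of fixed elements.
    R-id : Fin N → ∀ x → R x ≡ x
    R-id i (gen β) = R-β
    R-id i (gen (α j)) = R-α j
    R-id i (nul 𝟘) = fixes-product R-β² R-β²
    R-id i (nul β²) = R-β²
    R-id i (nul γ) = R-γ i
    R-id i (nul (ε j)) = begin
      R (nul (ε j))             ≡⟨ cong (R ∘ nul) (α-square j) ⟨
      R (gen (α j) * gen (α j)) ≡⟨ fixes-product (R-α j) (R-α j) ⟩
      nul (α j ⊗ α j)           ≡⟨ cong nul (α-square j) ⟩
      nul (ε j)                 ∎
      where open ≡-Reasoning

  rigid : Fin N → IsRigid _*_ f
  rigid i R R-hom R-idem R-resp = Rigidity.R-id R R-hom R-idem R-resp i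

  gen↔ : Fin (suc N) ↔ Gen N
  gen↔ = mk↔ₛ′ to from to-from from-to
    where
    to : Fin (suc N) → Gen N
    to zero = β
    to (suc i) = α i
    from : Gen N → Fin (suc N)
    from β = zero
    from (α i) = suc i
    to-from : ∀ g → to (from g) ≡ g
    to-from β = refl
    to-from (α _) = refl
    from-to : ∀ i → from (to i) ≡ i
    from-to zero = refl
    from-to (suc _) = refl

  null↔ : Fin (3 + N) ↔ Null N
  null↔ = mk↔ₛ′ to from to-from from-to
    where
    to : Fin (3 + N) → Null N
    to zero = 𝟘
    to (suc zero) = β²
    to (suc (suc zero)) = γ
    to (suc (suc (suc i))) = ε i
    from : Null N → Fin (3 + N)
    from 𝟘 = zero
    from β² = suc zero
    from γ = suc (suc zero)
    from (ε i) = suc (suc (suc i))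
    to-from : ∀ z → to (from z) ≡ z
    to-from 𝟘 = refl
    to-from β² = refl
    to-from γ = refl
    to-from (ε _) = refl
    from-to : ∀ i → from (to i) ≡ i
    from-to zero = refl
    from-to (suc zero) = refl
    from-to (suc (suc zero)) = refl
    from-to (suc (suc (suc _))) = refl

  elt↔ : (Gen N ⊎ Null N) ↔ Elt N
  elt↔ = mk↔ₛ′ to from to-from from-to
    where
    to : Gen N ⊎ Null N → Elt N
    to (inj₁ g) = gen g
    to (inj₂ z) = nul z
    from : Elt N → Gen N ⊎ Null N
    from (gen g) = inj₁ g
    from (nul z) = inj₂ z
    to-from : ∀ x → to (from x) ≡ x
    to-from (gen _) = refl
    to-from (nul _) = refl
    from-to : ∀ s → from (to s) ≡ s
    from-to (inj₁ _) = refl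
    from-to (inj₂ _) = refl

  code : Fin (suc N + (3 + N)) ↔ Elt N
  code = ↔-trans +↔⊎ (↔-trans (gen↔ ⊎-↔ null↔) elt↔)

mainTheorem9 : ∀ (n : ℕ) → Σ FinSemigroup λ X → size X ≥ n × (∃ λ (f : Fin (size X) → Z) → IsHomToZ X f × Surjective f × IsFCore X f)
mainTheorem9 n =
  semigroup , large ,
  f ∘ decode , hom-transport f f-hom ,
  surjective-transport f (f-surjective zero) ,
  core-transport f (rigid zero)
  where
  open Transport (code {suc n}) _*_ *-assoc
  open Inverse (code {suc n}) using () renaming (to to decode)

  large : suc (suc n) + (3 + suc n) ≥ n
  large = ≤-trans (m≤n+m n 2) (m≤m+n (suc (suc n)) (3 + suc n))
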